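{- Let $\psi \in \mathbb{C}$ be a root of unity of (multiplicative) order $b$, where $b \ge 3$ and $b \not\equiv 0 \pmod 4$. Then for every $t \in \mathbb{N}$, $\psi$ is a root of neither of the polynomials \[ P_1(x) = 2x^{4t+3} + x^{2t+8} - x^{2t} - 2x^5 \quad\text{and}\quad P_2(x) = 2x^{4t+3} - x^{2t+8} + x^{2t} - 2x^5. \] -}

module Defs where

open import Level using (Level; _⊔_)
open import Data.Nat as ℕ using (ℕ; zero; suc)
open import Data.Product using (_×_)
open import Relation.Nullary using (¬_)
open import Algebra.Bundles using (CommutativeRing)

module _ {c ℓ : Level} (R : CommutativeRing c ℓ) where
  open CommutativeRing R

  pow : Carrier → ℕ → Carrier
  pow x zero    = 1#
  pow x (suc n) = x * pow x n

  fromℕ : ℕ → Carrier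
  fromℕ zero    = 0#
  fromℕ (suc n) = 1# + fromℕ n

  NoZeroDivisors : Set (c ⊔ ℓ)
  NoZeroDivisors = ∀ x y → x * y ≈ 0# → (x ≈ 0#) Data.Sum.⊎ (y ≈ 0#)
    where import Data.Sum

  CharZero : Set ℓ
  CharZero = ∀ n → ¬ (fromℕ (suc n) ≈ 0#)

  HasOrder : Carrier → ℕ → Set ℓ
  HasOrder ψ b = (pow ψ b ≈ 1#) × (∀ k → 1 ℕ.≤ k → k ℕ.< b → ¬ (pow ψ k ≈ 1#))

  P₁ : ℕ → Carrier → Carrier
  P₁ t x = fromℕ 2 * pow x (4 ℕ.* t ℕ.+ 3) + pow x (2 ℕ.* t ℕ.+ 8)
           - pow x (2 ℕ.* t) - fromℕ 2 * pow x 5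

  P₂ : ℕ → Carrier → Carrier
  P₂ t x = fromℕ 2 * pow x (4 ℕ.* t ℕ.+ 3) - pow x (2 ℕ.* t ℕ.+ 8)
           + pow x (2 ℕ.* t) - fromℕ 2 * pow x 5

-- Let ℤ[ψ] be the additive span of the powers of ψ. At a root of P₁ or P₂ we have
-- ψ^(2t) (ψ⁸ − 1) = ±2 (ψ⁵ − ψ^(4t+3)), and ψ is a unit of ℤ[ψ], so ψ⁸ ≡ 1 (mod 2ℤ[ψ]).
-- Since 4 ∤ b, y = ψ⁸ satisfies y^m = 1 for some odd m, and y ≠ 1 since b ∤ 8; hence
-- 0 = 1 + y + ⋯ + y^(m−1) ≡ m ≡ 1 (mod 2), i.e. 1/2 ∈ ℤ[ψ]. In a domain of characteristic
-- zero this is impossible: by Nakayama's lemma for the finitely generated ℤ-module ℤ[ψ] and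
-- the prime 2, every generator, in particular 1, would vanish.

module Submission where

open import Defs
open import Level using (Level; _⊔_; 0ℓ)
open import Data.Nat as ℕ using (ℕ; zero; suc; _≤_; _<_; _%_; s≤s; z≤n; NonZero)
import Data.Nat.Properties as ℕ
open import Data.Nat.DivMod using (_/_; m≡m%n+[m/n]*n; m%n<n)
open import Data.Nat.Divisibility using (_∣_; divides; n∣m*n)
open import Data.Nat.Tactic.RingSolver using () renaming (solve to ℕ-solve)
open import Data.Product using (_×_; _,_; ∃-syntax; ∃₂)
open import Data.Product.Properties using () renaming (≡-dec to ×-≡-dec)
open import Data.Sum using ([_,_]′)
open import Data.Maybe using (Maybe; just; nothing)
open import Data.List using (List; []; _∷_; [_]; applyUpTo)
open import Data.List.Membership.Propositional using (_∈_)
open import Data.List.Membership.Propositional.Properties using (∈-applyUpTo⁺; ∈-applyUpTo⁻)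
open import Data.List.Relation.Unary.Any using (here; there)
open import Function using (_∘_; id)
open import Relation.Nullary using (¬_; yes; no; contradiction)
open import Relation.Binary.PropositionalEquality using (_≡_; _≢_)
import Relation.Binary.PropositionalEquality as ≡
open import Algebra.Bundles using (CommutativeRing; RawRing)
import Algebra.Solver.Ring.AlmostCommutativeRing as ACR

-- Algebra.Solver.Ring needs coefficients with decidable equality; integers, encoded as
-- pairs of naturals, map into every commutative ring.
module IntegerCoefficientSolver {c ℓ : Level} (R : CommutativeRing c ℓ) where
  open CommutativeRing R hiding (zero)
  open import Algebra.Properties.Ring ring
    using (-‿+-comm; -0#≈0#; ⁻¹-anti-homo‿-; [y-z]x≈yx-zx; x[y-z]≈xy-xz)
  open import Algebra.Properties.CommutativeSemigroup +-commutativeSemigroup using (interchange)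
  open import Algebra.Properties.Semiring.Mult semiring
    using () renaming (_×_ to _·_; ×-homo-+ to ·-homo-+; ×1-homo-* to ·1-homo-*)
  open import Algebra.Properties.Monoid.Mult.TCOptimised +-monoid
    using () renaming (_×_ to _·′_; ×ᵤ≈× to ·≈·′)
  open import Relation.Binary.Reasoning.Setoid setoid

  private
    [a+b]-[c+d]≈[a-c]+[b-d] : ∀ a b c d → (a + b) - (c + d) ≈ (a - c) + (b - d)
    [a+b]-[c+d]≈[a-c]+[b-d] a b c d = begin
      (a + b) - (c + d)    ≈⟨ +-congˡ (-‿+-comm c d) ⟨
      (a + b) + (- c - d)  ≈⟨ interchange a b (- c) (- d) ⟩
      (a - c) + (b - d)    ∎

    [a-b]-[c-d]≈[a+d]-[b+c] : ∀ a b c d → (a - b) - (c - d) ≈ (a + d) - (b + c)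
    [a-b]-[c-d]≈[a+d]-[b+c] a b c d = begin
      (a - b) - (c - d)  ≈⟨ +-congˡ (⁻¹-anti-homo‿- c d) ⟩
      (a - b) + (d - c)  ≈⟨ [a+b]-[c+d]≈[a-c]+[b-d] a d b c ⟨
      (a + d) - (b + c)  ∎

  difference : ℕ × ℕ → Carrier
  difference (m , n) = m · 1# - n · 1#

  difference-+ : ∀ m n p q → difference (m ℕ.+ p , n ℕ.+ q) ≈ difference (m , n) + difference (p , q)
  difference-+ m n p q = begin
    (m ℕ.+ p) · 1# - (n ℕ.+ q) · 1#        ≈⟨ +-cong (·-homo-+ 1# m p) (-‿cong (·-homo-+ 1# n q)) ⟩
    (m · 1# + p · 1#) - (n · 1# + q · 1#)  ≈⟨ [a+b]-[c+d]≈[a-c]+[b-d] _ _ _ _ ⟩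
    difference (m , n) + difference (p , q) ∎

  difference-* : ∀ m n p q →
                 difference (m ℕ.* p ℕ.+ n ℕ.* q , m ℕ.* q ℕ.+ n ℕ.* p) ≈ difference (m , n) * difference (p , q)
  difference-* m n p q = begin
    (m ℕ.* p ℕ.+ n ℕ.* q) · 1# - (m ℕ.* q ℕ.+ n ℕ.* p) · 1#
      ≈⟨ +-cong (trans (·-homo-+ 1# (m ℕ.* p) (n ℕ.* q)) (+-cong (·1-homo-* m p) (·1-homo-* n q)))
                (-‿cong (trans (·-homo-+ 1# (m ℕ.* q) (n ℕ.* p)) (+-cong (·1-homo-* m q) (·1-homo-* n p)))) ⟩
    (M * P + N * Q) - (M * Q + N * P)  ≈⟨ [a-b]-[c-d]≈[a+d]-[b+c] (M * P) (M * Q) (N * P) (N * Q) ⟨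
    (M * P - M * Q) - (N * P - N * Q)  ≈⟨ +-cong (x[y-z]≈xy-xz M P Q) (-‿cong (x[y-z]≈xy-xz N P Q)) ⟨
    M * (P - Q) - N * (P - Q)          ≈⟨ [y-z]x≈yx-zx (P - Q) M N ⟨
    (M - N) * (P - Q)                  ∎
    where M = m · 1#; N = n · 1#; P = p · 1#; Q = q · 1#

  private
    -- (m , n) stands for m − n; the normal forms (m , 0) and (0 , n) make equality of
    -- integers syntactic, and ⟦_⟧ sends (1 , 0) to 1# on the nose.
    normalise : ℕ × ℕ → ℕ × ℕ
    normalise (suc m , suc n) = normalise (m , n)
    normalise (zero  , n)     = zero , n
    normalise (suc m , zero)  = suc m , zero

    difference-normalise : ∀ p → difference (normalise p) ≈ difference p
    difference-normalise (suc m , suc n) = begin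
      difference (normalise (m , n))  ≈⟨ difference-normalise (m , n) ⟩
      m · 1# - n · 1#                 ≈⟨ +-identityˡ _ ⟨
      0# + (m · 1# - n · 1#)          ≈⟨ +-congʳ (-‿inverseʳ 1#) ⟨
      (1# - 1#) + (m · 1# - n · 1#)   ≈⟨ [a+b]-[c+d]≈[a-c]+[b-d] 1# _ 1# _ ⟨
      suc m · 1# - suc n · 1#         ∎
    difference-normalise (zero  , n)    = refl
    difference-normalise (suc m , zero) = refl

    ℤ-rawRing : RawRing 0ℓ 0ℓ
    ℤ-rawRing = record
      { Carrier = ℕ × ℕ
      ; _≈_     = _≡_
      ; _+_     = λ { (m , n) (p , q) → normalise (m ℕ.+ p , n ℕ.+ q) }
      ; _*_     = λ { (m , n) (p , q) → normalise (m ℕ.* p ℕ.+ n ℕ.* q , m ℕ.* q ℕ.+ n ℕ.* p) }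
      ; -_      = λ { (m , n) → n , m }
      ; 0#      = 0 , 0
      ; 1#      = 1 , 0
      }

    ⟦_⟧ : ℕ × ℕ → Carrier
    ⟦ m , zero  ⟧ = m ·′ 1#
    ⟦ m , suc n ⟧ = m ·′ 1# - suc n ·′ 1#

    ⟦⟧≈difference : ∀ p → ⟦ p ⟧ ≈ difference p
    ⟦⟧≈difference (m , zero)  = begin
      m ·′ 1#       ≈⟨ ·≈·′ m 1# ⟨
      m · 1#        ≈⟨ +-identityʳ _ ⟨
      m · 1# + 0#   ≈⟨ +-congˡ -0#≈0# ⟨
      m · 1# - 0#   ∎
    ⟦⟧≈difference (m , suc n) = +-cong (sym (·≈·′ m 1#)) (-‿cong (sym (·≈·′ (suc n) 1#)))

    ⟦normalise⟧≈difference : ∀ p → ⟦ normalise p ⟧ ≈ difference p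
    ⟦normalise⟧≈difference p = trans (⟦⟧≈difference (normalise p)) (difference-normalise p)

    morphism : ℤ-rawRing ACR.-Raw-AlmostCommutative⟶ ACR.fromCommutativeRing R
    morphism = record
      { ⟦_⟧    = ⟦_⟧
      ; +-homo = λ { (m , n) (p , q) → trans (⟦normalise⟧≈difference (m ℕ.+ p , n ℕ.+ q))
                       (trans (difference-+ m n p q) (sym (+-cong (⟦⟧≈difference (m , n)) (⟦⟧≈difference (p , q))))) }
      ; *-homo = λ { (m , n) (p , q) → trans (⟦normalise⟧≈difference (m ℕ.* p ℕ.+ n ℕ.* q , m ℕ.* q ℕ.+ n ℕ.* p))
                       (trans (difference-* m n p q) (sym (*-cong (⟦⟧≈difference (m , n)) (⟦⟧≈difference (p , q))))) }
      ; -‿homo = λ { (m , n) → trans (⟦⟧≈difference (n , m))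
                       (trans (sym (⁻¹-anti-homo‿- _ _)) (-‿cong (sym (⟦⟧≈difference (m , n))))) }
      ; 0-homo = refl
      ; 1-homo = refl
      }

    ⟦⟧-≟ : ∀ p q → Maybe (⟦ p ⟧ ≈ ⟦ q ⟧)
    ⟦⟧-≟ p q with ×-≡-dec ℕ._≟_ ℕ._≟_ p q
    ... | yes ≡.refl = just refl
    ... | no _       = nothing

  open import Algebra.Solver.Ring ℤ-rawRing (ACR.fromCommutativeRing R) morphism ⟦⟧-≟ public
    using (Polynomial; solve; _:=_; con; _:+_; _:*_; _:-_; :-_)

  :0 :1 : ∀ {n} → Polynomial n
  :0 = con (0 , 0)
  :1 = con (1 , 0)


module Mod2 {c ℓ : Level} (R : CommutativeRing c ℓ) where
  open CommutativeRing R hiding (zero)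
  open IntegerCoefficientSolver R
  open import Algebra.Properties.Ring ring
    using (-0#≈0#; -‿distribˡ-*; -‿distribʳ-*; +-cancelˡ; x∙y⁻¹≈ε⇒x≈y)
  open import Algebra.Properties.Semiring.Mult semiring
    using () renaming (_×_ to _·_; ×1-homo-* to ·1-homo-*)
  open import Algebra.Properties.CommutativeSemigroup *-commutativeSemigroup using (x∙yz≈y∙xz)
  open import Relation.Binary.Reasoning.Setoid setoid

  infixr 8 _^_
  _^_ : Carrier → ℕ → Carrier
  _^_ = pow R

  ^-homo-* : ∀ x m n → x ^ (m ℕ.+ n) ≈ x ^ m * x ^ n
  ^-homo-* x zero    n = sym (*-identityˡ _)
  ^-homo-* x (suc m) n = trans (*-congˡ (^-homo-* x m n)) (sym (*-assoc _ _ _))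

  ^-assocʳ : ∀ x m n → (x ^ m) ^ n ≈ x ^ (m ℕ.* n)
  ^-assocʳ x m zero    = reflexive (≡.cong (x ^_) (≡.sym (ℕ.*-zeroʳ m)))
  ^-assocʳ x m (suc n) = begin
    x ^ m * (x ^ m) ^ n    ≈⟨ *-congˡ (^-assocʳ x m n) ⟩
    x ^ m * x ^ (m ℕ.* n)  ≈⟨ ^-homo-* x m (m ℕ.* n) ⟨
    x ^ (m ℕ.+ m ℕ.* n)    ≡⟨ ≡.cong (x ^_) (ℕ.*-suc m n) ⟨
    x ^ (m ℕ.* suc n)      ∎

  ^-congˡ : ∀ {x y} n → x ≈ y → x ^ n ≈ y ^ n
  ^-congˡ zero    x≈y = refl
  ^-congˡ (suc n) x≈y = *-cong x≈y (^-congˡ n x≈y)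

  1^n≈1 : ∀ n → 1# ^ n ≈ 1#
  1^n≈1 zero    = refl
  1^n≈1 (suc n) = trans (*-identityˡ _) (1^n≈1 n)

  fromℕ≡·1# : ∀ n → fromℕ R n ≡ n · 1#
  fromℕ≡·1# zero    = ≡.refl
  fromℕ≡·1# (suc n) = ≡.cong (1# +_) (fromℕ≡·1# n)

  ·1#-injective : CharZero R → ∀ m n → m · 1# ≈ n · 1# → m ≡ n
  ·1#-injective char0 zero    zero    _  = ≡.refl
  ·1#-injective char0 zero    (suc n) eq = contradiction (trans (reflexive (fromℕ≡·1# (suc n))) (sym eq)) (char0 n)
  ·1#-injective char0 (suc m) zero    eq = contradiction (trans (reflexive (fromℕ≡·1# (suc m))) eq) (char0 m)
  ·1#-injective char0 (suc m) (suc n) eq = ≡.cong suc (·1#-injective char0 m n (+-cancelˡ 1# _ _ eq))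

  two : Carrier
  two = 2 · 1#

  infixl 6 _+ₛ_
  infix  8 -ₛ_
  data Span (G : List Carrier) : Carrier → Set (c ⊔ ℓ) where
    gen  : ∀ {g} → g ∈ G → Span G g
    0ₛ   : Span G 0#
    _+ₛ_ : ∀ {a b} → Span G a → Span G b → Span G (a + b)
    -ₛ_  : ∀ {a} → Span G a → Span G (- a)
    resp : ∀ {a b} → a ≈ b → Span G a → Span G b

  IsInteger : Carrier → Set (c ⊔ ℓ)
  IsInteger = Span [ 1# ]

  span-integer-* : ∀ {G k s} → IsInteger k → Span G s → Span G (k * s)
  span-integer-* (gen (here ≡.refl)) s = resp (sym (*-identityˡ _)) s
  span-integer-* 0ₛ                  s = resp (sym (zeroˡ _)) 0ₛ
  span-integer-* (k +ₛ l)            s = resp (sym (distribʳ _ _ _)) (span-integer-* k s +ₛ span-integer-* l s)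
  span-integer-* (-ₛ k)              s = resp (-‿distribˡ-* _ _) (-ₛ span-integer-* k s)
  span-integer-* (resp k≈l k)        s = resp (*-congʳ k≈l) (span-integer-* k s)

  span-*-closed : ∀ {G} → (∀ {g h} → g ∈ G → h ∈ G → Span G (g * h)) →
                  ∀ {a b} → Span G a → Span G b → Span G (a * b)
  span-*-closed {G} gen-* = span-*
    where
    gen-*-span : ∀ {g b} → g ∈ G → Span G b → Span G (g * b)
    gen-*-span g∈G (gen h∈G)    = gen-* g∈G h∈G
    gen-*-span g∈G 0ₛ           = resp (sym (zeroʳ _)) 0ₛ
    gen-*-span g∈G (b +ₛ b′)    = resp (sym (distribˡ _ _ _)) (gen-*-span g∈G b +ₛ gen-*-span g∈G b′)
    gen-*-span g∈G (-ₛ b)       = resp (-‿distribʳ-* _ _) (-ₛ gen-*-span g∈G b)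
    gen-*-span g∈G (resp b≈b′ b) = resp (*-congˡ b≈b′) (gen-*-span g∈G b)

    span-* : ∀ {a b} → Span G a → Span G b → Span G (a * b)
    span-* (gen g∈G)     b = gen-*-span g∈G b
    span-* 0ₛ            b = resp (sym (zeroˡ _)) 0ₛ
    span-* (a +ₛ a′)     b = resp (sym (distribʳ _ _ _)) (span-* a b +ₛ span-* a′ b)
    span-* (-ₛ a)        b = resp (-‿distribˡ-* _ _) (-ₛ span-* a b)
    span-* (resp a≈a′ a) b = resp (*-congʳ a≈a′) (span-* a b)

  span-∷ : ∀ {h G s} → Span (h ∷ G) s → ∃₂ λ k s′ → IsInteger k × Span G s′ × s ≈ k * h + s′
  span-∷ {h} (gen (here ≡.refl)) = 1# , 0# , gen (here ≡.refl) , 0ₛ , solve 1 (λ h → h := :1 :* h :+ :0) refl h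
  span-∷ {h} (gen {g} (there g∈G)) = 0# , g , 0ₛ , gen g∈G , solve 2 (λ h g → g := :0 :* h :+ g) refl h g
  span-∷ {h} 0ₛ = 0# , 0# , 0ₛ , 0ₛ , solve 1 (λ h → :0 := :0 :* h :+ :0) refl h
  span-∷ {h} (s +ₛ t) with span-∷ s | span-∷ t
  ... | k , s′ , k∈ℤ , s′∈G , s≈ | l , t′ , l∈ℤ , t′∈G , t≈ =
    k + l , s′ + t′ , k∈ℤ +ₛ l∈ℤ , s′∈G +ₛ t′∈G ,
    trans (+-cong s≈ t≈)
      (solve 5 (λ k l s′ t′ h → (k :* h :+ s′) :+ (l :* h :+ t′) := (k :+ l) :* h :+ (s′ :+ t′)) refl k l s′ t′ h)
  span-∷ {h} (-ₛ s) with span-∷ s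
  ... | k , s′ , k∈ℤ , s′∈G , s≈ =
    - k , - s′ , -ₛ k∈ℤ , -ₛ s′∈G ,
    trans (-‿cong s≈) (solve 3 (λ k s′ h → :- (k :* h :+ s′) := (:- k) :* h :+ (:- s′)) refl k s′ h)
  span-∷ (resp s≈t s) with span-∷ s
  ... | k , s′ , k∈ℤ , s′∈G , s≈ = k , s′ , k∈ℤ , s′∈G , trans (sym s≈t) s≈

  span-zero : ∀ {G} → (∀ {g} → g ∈ G → g ≈ 0#) → ∀ {s} → Span G s → s ≈ 0#
  span-zero G≈0 (gen g∈G)    = G≈0 g∈G
  span-zero G≈0 0ₛ           = refl
  span-zero G≈0 (s +ₛ t)     = trans (+-cong (span-zero G≈0 s) (span-zero G≈0 t)) (+-identityʳ 0#)
  span-zero G≈0 (-ₛ s)       = trans (-‿cong (span-zero G≈0 s)) -0#≈0#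
  span-zero G≈0 (resp s≈t s) = trans (sym s≈t) (span-zero G≈0 s)

  integer-difference : ∀ {z} → IsInteger z → ∃₂ λ m n → z ≈ m · 1# - n · 1#
  integer-difference (gen (here ≡.refl)) = 1 , 0 , solve 0 (:1 := (:1 :+ :0) :- :0) refl
  integer-difference 0ₛ = 0 , 0 , sym (-‿inverseʳ 0#)
  integer-difference (z +ₛ w) with integer-difference z | integer-difference w
  ... | m , n , z≈ | p , q , w≈ = m ℕ.+ p , n ℕ.+ q , trans (+-cong z≈ w≈) (sym (difference-+ m n p q))
  integer-difference (-ₛ z) with integer-difference z
  ... | m , n , z≈ = n , m , trans (-‿cong z≈) (solve 2 (λ x y → :- (x :- y) := y :- x) refl (m · 1#) (n · 1#))
  integer-difference (resp z≈w z) with integer-difference z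
  ... | m , n , z≈ = m , n , trans (sym z≈w) z≈

  Odd : Carrier → Set (c ⊔ ℓ)
  Odd d = ∃[ z ] IsInteger z × d ≈ 1# + two * z

  two-integer : IsInteger two
  two-integer = gen (here ≡.refl) +ₛ (gen (here ≡.refl) +ₛ 0ₛ)

  odd-integer : ∀ {d} → Odd d → IsInteger d
  odd-integer (z , z∈ℤ , d≈) = resp (sym d≈) (gen (here ≡.refl) +ₛ span-integer-* two-integer z∈ℤ)

  odd-* : ∀ {d e} → Odd d → Odd e → Odd (d * e)
  odd-* (z , z∈ℤ , d≈) (w , w∈ℤ , e≈) =
    z + w + two * z * w ,
    z∈ℤ +ₛ w∈ℤ +ₛ span-integer-* (span-integer-* two-integer z∈ℤ) w∈ℤ ,
    trans (*-cong d≈ e≈)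
      (solve 3 (λ t z w → (:1 :+ t :* z) :* (:1 :+ t :* w)
                        := :1 :+ t :* (z :+ w :+ t :* z :* w)) refl two z w)

  odd-sub-even : ∀ {d k} → Odd d → IsInteger k → Odd (d - two * k)
  odd-sub-even {k = k} (z , z∈ℤ , d≈) k∈ℤ =
    z - k , z∈ℤ +ₛ (-ₛ k∈ℤ) ,
    trans (+-congʳ d≈) (solve 3 (λ t z k → (:1 :+ t :* z) :- t :* k := :1 :+ t :* (z :- k)) refl two z k)

  odd≉0 : CharZero R → ∀ {d} → Odd d → ¬ d ≈ 0#
  odd≉0 char0 {d} (z , z∈ℤ , d≈) d≈0 with integer-difference z∈ℤ
  ... | m , n , z≈ = ℕ.even≢odd n m (≡.sym (·1#-injective char0 _ _ (x∙y⁻¹≈ε⇒x≈y _ _ odd-even≈0)))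
    where
    odd-even≈0 : suc (2 ℕ.* m) · 1# - (2 ℕ.* n) · 1# ≈ 0#
    odd-even≈0 = begin
      (1# + (2 ℕ.* m) · 1#) - (2 ℕ.* n) · 1#
        ≈⟨ +-cong (+-congˡ (·1-homo-* 2 m)) (-‿cong (·1-homo-* 2 n)) ⟩
      (1# + two * m · 1#) - two * n · 1#
        ≈⟨ solve 3 (λ t x y → (:1 :+ t :* x) :- t :* y := :1 :+ t :* (x :- y)) refl two (m · 1#) (n · 1#) ⟩
      1# + two * (m · 1# - n · 1#)
        ≈⟨ +-congˡ (*-congˡ z≈) ⟨
      1# + two * z
        ≈⟨ d≈ ⟨
      d
        ≈⟨ d≈0 ⟩
      0# ∎

  TwiceSpan : List Carrier → Carrier → Set (c ⊔ ℓ)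
  TwiceSpan G a = ∃[ s ] Span G s × a ≈ two * s

  twice-resp : ∀ {G a b} → a ≈ b → TwiceSpan G a → TwiceSpan G b
  twice-resp a≈b (s , s∈G , a≈) = s , s∈G , trans (sym a≈b) a≈

  OddMultiplesInTwiceSpan : List Carrier → Set (c ⊔ ℓ)
  OddMultiplesInTwiceSpan G = ∀ {g} → g ∈ G → ∃[ d ] Odd d × TwiceSpan G (d * g)

  twice-span-∷ : ∀ {h G e a} → IsInteger e → TwiceSpan G (e * h) → TwiceSpan (h ∷ G) a → TwiceSpan G (e * a)
  twice-span-∷ {h} {e = e} {a} e∈ℤ (s , s∈G , eh≈) (t , t∈hG , a≈) with span-∷ t∈hG
  ... | k , t′ , k∈ℤ , t′∈G , t≈ =
    k * (two * s) + e * t′ ,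
    span-integer-* k∈ℤ (span-integer-* two-integer s∈G) +ₛ span-integer-* e∈ℤ t′∈G ,
    (begin
      e * a
        ≈⟨ *-congˡ (trans a≈ (*-congˡ t≈)) ⟩
      e * (two * (k * h + t′))
        ≈⟨ solve 5 (λ e t k h t′ → e :* (t :* (k :* h :+ t′)) := t :* (k :* (e :* h) :+ e :* t′)) refl e two k h t′ ⟩
      two * (k * (e * h) + e * t′)
        ≈⟨ *-congˡ (+-congʳ (*-congˡ eh≈)) ⟩
      two * (k * (two * s) + e * t′) ∎)

  odd-multiple-of-head : ∀ {h G} → OddMultiplesInTwiceSpan (h ∷ G) → ∃[ e ] Odd e × TwiceSpan G (e * h)
  odd-multiple-of-head {h} H with H (here ≡.refl)
  ... | d , d-odd , t , t∈hG , dh≈ with span-∷ t∈hG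
  ... | k , t′ , k∈ℤ , t′∈G , t≈ =
    d - two * k , odd-sub-even d-odd k∈ℤ , t′ , t′∈G ,
    (begin
      (d - two * k) * h
        ≈⟨ solve 4 (λ d t k h → (d :- t :* k) :* h := d :* h :- t :* (k :* h)) refl d two k h ⟩
      d * h - two * (k * h)
        ≈⟨ +-congʳ (trans dh≈ (*-congˡ t≈)) ⟩
      two * (k * h + t′) - two * (k * h)
        ≈⟨ solve 4 (λ t k h t′ → t :* (k :* h :+ t′) :- t :* (k :* h) := t :* t′) refl two k h t′ ⟩
      two * t′ ∎)

  odd-multiples-of-tail : ∀ {h G e} → OddMultiplesInTwiceSpan (h ∷ G) → Odd e → TwiceSpan G (e * h) →
                          OddMultiplesInTwiceSpan G
  odd-multiples-of-tail H e-odd eh∈2G g∈G with H (there g∈G)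
  ... | d , d-odd , dg∈2hG =
    _ , odd-* e-odd d-odd , twice-resp (sym (*-assoc _ _ _)) (twice-span-∷ (odd-integer e-odd) eh∈2G dg∈2hG)

  -- Nakayama's lemma, proved by eliminating one generator at a time.
  odd-multiples-vanish : NoZeroDivisors R → CharZero R → ∀ G → OddMultiplesInTwiceSpan G →
                         ∀ {g} → g ∈ G → g ≈ 0#
  odd-multiples-vanish nzd char0 (h ∷ G) H with odd-multiple-of-head H
  ... | e , e-odd , s , s∈G , eh≈ = λ { (here ≡.refl) → h≈0 ; (there g∈G) → G≈0 g∈G }
    where
    G≈0 : ∀ {g} → g ∈ G → g ≈ 0#
    G≈0 = odd-multiples-vanish nzd char0 G (odd-multiples-of-tail H e-odd (s , s∈G , eh≈))

    eh≈0 : e * h ≈ 0#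
    eh≈0 = trans eh≈ (trans (*-congˡ (span-zero G≈0 s∈G)) (zeroʳ two))

    h≈0 : h ≈ 0#
    h≈0 = [ (λ e≈0 → contradiction e≈0 (odd≉0 char0 e-odd)) , id ]′ (nzd e h eh≈0)

  geometric : Carrier → ℕ → Carrier
  geometric y zero    = 0#
  geometric y (suc n) = 1# + y * geometric y n

  geometric-telescope : ∀ y n → (y - 1#) * geometric y n ≈ y ^ n - 1#
  geometric-telescope y zero    = trans (zeroʳ _) (sym (-‿inverseʳ 1#))
  geometric-telescope y (suc n) = begin
    (y - 1#) * (1# + y * geometric y n)
      ≈⟨ solve 2 (λ y g → (y :- :1) :* (:1 :+ y :* g) := y :* ((y :- :1) :* g) :+ y :- :1) refl y (geometric y n) ⟩
    y * ((y - 1#) * geometric y n) + y - 1#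
      ≈⟨ +-congʳ (+-congʳ (*-congˡ (geometric-telescope y n))) ⟩
    y * (y ^ n - 1#) + y - 1#
      ≈⟨ solve 2 (λ y p → y :* (p :- :1) :+ y :- :1 := y :* p :- :1) refl y (y ^ n) ⟩
    y * y ^ n - 1# ∎

  module Subring {G : List Carrier} (1∈G : 1# ∈ G)
                 (span-* : ∀ {a b} → Span G a → Span G b → Span G (a * b)) where

    span-·1# : ∀ n → Span G (n · 1#)
    span-·1# zero    = 0ₛ
    span-·1# (suc n) = gen 1∈G +ₛ span-·1# n

    twice-+ : ∀ {a b} → TwiceSpan G a → TwiceSpan G b → TwiceSpan G (a + b)
    twice-+ (s , s∈G , a≈) (t , t∈G , b≈) = s + t , s∈G +ₛ t∈G , trans (+-cong a≈ b≈) (sym (distribˡ two s t))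

    twice-* : ∀ {a b} → Span G a → TwiceSpan G b → TwiceSpan G (a * b)
    twice-* {a} a∈G (s , s∈G , b≈) = a * s , span-* a∈G s∈G , trans (*-congˡ b≈) (x∙yz≈y∙xz a two s)

    1∉twice : NoZeroDivisors R → CharZero R → ¬ TwiceSpan G 1#
    1∉twice nzd char0 1∈2G = char0 0 (trans (+-identityʳ 1#) (odd-multiples-vanish nzd char0 G odd-multiples 1∈G))
      where
      1-odd : Odd 1#
      1-odd = 0# , 0ₛ , sym (trans (+-congˡ (zeroʳ two)) (+-identityʳ 1#))

      odd-multiples : OddMultiplesInTwiceSpan G
      odd-multiples {g} g∈G = 1# , 1-odd , twice-resp (*-comm g 1#) (twice-* (gen g∈G) 1∈2G)

    geometric-twice : ∀ {y} → Span G y → TwiceSpan G (y - 1#) → ∀ n → TwiceSpan G (geometric y n - n · 1#)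
    geometric-twice y∈G y≡1 zero    = 0# , 0ₛ , trans (-‿inverseʳ 0#) (sym (zeroʳ two))
    geometric-twice {y} y∈G y≡1 (suc n) =
      twice-resp (sym telescope) (twice-+ (twice-* y∈G (geometric-twice y∈G y≡1 n)) (twice-* (span-·1# n) y≡1))
      where
      telescope : (1# + y * geometric y n) - (1# + n · 1#) ≈ y * (geometric y n - n · 1#) + n · 1# * (y - 1#)
      telescope = solve 3
        (λ y g m → (:1 :+ y :* g) :- (:1 :+ m) := y :* (g :- m) :+ m :* (y :- :1)) refl y (geometric y n) (n · 1#)

    odd-order-root-≢1 : NoZeroDivisors R → CharZero R → ∀ {y} q → Span G y → ¬ y ≈ 1# →
                        y ^ suc (2 ℕ.* q) ≈ 1# → ¬ TwiceSpan G (y - 1#)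
    odd-order-root-≢1 nzd char0 {y} q y∈G y≉1 y^m≈1 y≡1 =
      1∉twice nzd char0
        (twice-resp 1≈ (twice-+ (twice-* (-ₛ gen 1∈G) (geometric-twice y∈G y≡1 m)) (- Q , -ₛ span-·1# q , refl)))
      where
      m = suc (2 ℕ.* q)
      Q = q · 1#

      geometric≈0 : geometric y m ≈ 0#
      geometric≈0 = [ (λ y-1≈0 → contradiction (x∙y⁻¹≈ε⇒x≈y y 1# y-1≈0) y≉1) , id ]′
        (nzd (y - 1#) (geometric y m) (trans (geometric-telescope y m) (trans (+-congʳ y^m≈1) (-‿inverseʳ 1#))))

      1≈ : - 1# * (geometric y m - m · 1#) + two * - Q ≈ 1#
      1≈ = begin
        - 1# * (geometric y m - (1# + (2 ℕ.* q) · 1#)) + two * - Q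
          ≈⟨ +-congʳ (*-congˡ (+-cong geometric≈0 (-‿cong (+-congˡ (·1-homo-* 2 q))))) ⟩
        - 1# * (0# - (1# + two * Q)) + two * - Q
          ≈⟨ solve 2 (λ t Q → :- :1 :* (:0 :- (:1 :+ t :* Q)) :+ t :* (:- Q) := :1) refl two Q ⟩
        1# ∎

  module Powers (x : Carrier) (n : ℕ) (x^[1+n]≈1 : x ^ suc n ≈ 1#) where

    powers : List Carrier
    powers = applyUpTo (x ^_) (suc n)

    ^-∣ : ∀ {k} → suc n ∣ k → x ^ k ≈ 1#
    ^-∣ (divides q ≡.refl) = begin
      x ^ (q ℕ.* suc n)  ≡⟨ ≡.cong (x ^_) (ℕ.*-comm q (suc n)) ⟩
      x ^ (suc n ℕ.* q)  ≈⟨ ^-assocʳ x (suc n) q ⟨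
      (x ^ suc n) ^ q    ≈⟨ ^-congˡ q x^[1+n]≈1 ⟩
      1# ^ q             ≈⟨ 1^n≈1 q ⟩
      1#                 ∎

    ^-mod : ∀ k → x ^ k ≈ x ^ (k % suc n)
    ^-mod k = begin
      x ^ k
        ≡⟨ ≡.cong (x ^_) (m≡m%n+[m/n]*n k (suc n)) ⟩
      x ^ (k % suc n ℕ.+ k / suc n ℕ.* suc n)
        ≈⟨ ^-homo-* x (k % suc n) _ ⟩
      x ^ (k % suc n) * x ^ (k / suc n ℕ.* suc n)
        ≈⟨ *-congˡ (^-∣ (n∣m*n (k / suc n))) ⟩
      x ^ (k % suc n) * 1#
        ≈⟨ *-identityʳ _ ⟩
      x ^ (k % suc n) ∎

    span-^ : ∀ k → Span powers (x ^ k)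
    span-^ k = resp (sym (^-mod k)) (gen (∈-applyUpTo⁺ (x ^_) (m%n<n k (suc n))))

    span-* : ∀ {a b} → Span powers a → Span powers b → Span powers (a * b)
    span-* = span-*-closed generator-*
      where
      generator-* : ∀ {g h} → g ∈ powers → h ∈ powers → Span powers (g * h)
      generator-* g∈ h∈ with ∈-applyUpTo⁻ (x ^_) g∈ | ∈-applyUpTo⁻ (x ^_) h∈
      ... | i , _ , ≡.refl | j , _ , ≡.refl = resp (^-homo-* x i j) (span-^ (i ℕ.+ j))

    open Subring (∈-applyUpTo⁺ (x ^_) (s≤s z≤n)) span-* public

    twice-cancel-^ : ∀ k {a} → TwiceSpan powers (x ^ k * a) → TwiceSpan powers a
    twice-cancel-^ k {a} xᵏa∈2G = twice-resp x⁻ᵏxᵏa≈a (twice-* (span-^ (k ℕ.* n)) xᵏa∈2G)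
      where
      x⁻ᵏxᵏa≈a : x ^ (k ℕ.* n) * (x ^ k * a) ≈ a
      x⁻ᵏxᵏa≈a = begin
        x ^ (k ℕ.* n) * (x ^ k * a)  ≈⟨ *-assoc _ _ _ ⟨
        x ^ (k ℕ.* n) * x ^ k * a    ≈⟨ *-congʳ (*-comm _ _) ⟩
        x ^ k * x ^ (k ℕ.* n) * a    ≈⟨ *-congʳ (^-homo-* x k (k ℕ.* n)) ⟨
        x ^ (k ℕ.+ k ℕ.* n) * a      ≡⟨ ≡.cong (λ e → x ^ e * a) (ℕ.*-suc k n) ⟨
        x ^ (k ℕ.* suc n) * a        ≈⟨ *-congʳ (^-∣ (n∣m*n k)) ⟩
        1# * a                       ≈⟨ *-identityˡ a ⟩
        a                            ∎

    ^≈1⇒%≡0 : (∀ k → 1 ≤ k → k < suc n → ¬ x ^ k ≈ 1#) → ∀ k → x ^ k ≈ 1# → k % suc n ≡ 0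
    ^≈1⇒%≡0 minimal k xᵏ≈1 with k % suc n ℕ.≟ 0
    ... | yes r≡0 = r≡0
    ... | no  r≢0 = contradiction (trans (sym (^-mod k)) xᵏ≈1) (minimal (k % suc n) (ℕ.n≢0⇒n>0 r≢0) (m%n<n k (suc n)))

  P₁-root : ∀ t x → P₁ R t x ≈ 0# → x ^ (2 ℕ.* t) * (x ^ 8 - 1#) ≈ two * (x ^ 5 - x ^ (4 ℕ.* t ℕ.+ 3))
  P₁-root t x P₁≈0 = begin
    A * (X - 1#)
      ≈⟨ solve 5 (λ a c e x t → a :* (x :- :1) := (t :* c :+ a :* x :- a :- t :* e) :+ t :* (e :- c)) refl A C E X two ⟩
    (two * C + A * X - A - two * E) + two * (E - C)
      ≈⟨ +-congʳ (trans (+-congʳ (+-congʳ (+-congˡ (sym (^-homo-* x (2 ℕ.* t) 8))))) P₁≈0) ⟩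
    0# + two * (E - C)
      ≈⟨ +-identityˡ _ ⟩
    two * (E - C) ∎
    where
    A = x ^ (2 ℕ.* t); C = x ^ (4 ℕ.* t ℕ.+ 3); E = x ^ 5; X = x ^ 8

  P₂-root : ∀ t x → P₂ R t x ≈ 0# → x ^ (2 ℕ.* t) * (x ^ 8 - 1#) ≈ two * (x ^ (4 ℕ.* t ℕ.+ 3) - x ^ 5)
  P₂-root t x P₂≈0 = begin
    A * (X - 1#)
      ≈⟨ solve 5 (λ a c e x t → a :* (x :- :1) := :- (t :* c :- a :* x :+ a :- t :* e) :+ t :* (c :- e)) refl A C E X two ⟩
    - (two * C - A * X + A - two * E) + two * (C - E)
      ≈⟨ +-congʳ (-‿cong (trans (+-congʳ (+-congʳ (+-congˡ (-‿cong (sym (^-homo-* x (2 ℕ.* t) 8)))))) P₂≈0)) ⟩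
    - 0# + two * (C - E)
      ≈⟨ +-congʳ -0#≈0# ⟩
    0# + two * (C - E)
      ≈⟨ +-identityˡ _ ⟩
    two * (C - E) ∎
    where
    A = x ^ (2 ℕ.* t); C = x ^ (4 ℕ.* t ℕ.+ 3); E = x ^ 5; X = x ^ 8

8%b≢0 : ∀ b .{{_ : NonZero b}} → 3 ≤ b → b % 4 ≢ 0 → 8 % b ≢ 0
8%b≢0 1 (s≤s ())
8%b≢0 2 (s≤s (s≤s ()))
8%b≢0 3 _ _ ()
8%b≢0 4 _ b%4≢0 _ = b%4≢0 ≡.refl
8%b≢0 5 _ _ ()
8%b≢0 6 _ _ ()
8%b≢0 7 _ _ ()
8%b≢0 8 _ b%4≢0 _ = b%4≢0 ≡.refl
8%b≢0 (suc (suc (suc (suc (suc (suc (suc (suc (suc b))))))))) _ _ ()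

∣8*odd : ∀ b → b % 4 ≢ 0 → ∃[ q ] b ∣ 8 ℕ.* suc (2 ℕ.* q)
∣8*odd b b%4≢0 with b % 4 | b / 4 | m≡m%n+[m/n]*n b 4 | m%n<n b 4
... | 0 | _ | _      | _ = contradiction ≡.refl b%4≢0
... | 1 | a | ≡.refl | _ = 2 ℕ.* a , divides 8 (ℕ-solve (a ∷ []))
... | 2 | a | ≡.refl | _ = a , divides 4 (ℕ-solve (a ∷ []))
... | 3 | a | ≡.refl | _ = suc (2 ℕ.* a) , divides 8 (ℕ-solve (a ∷ []))
... | suc (suc (suc (suc _))) | _ | _ | s≤s (s≤s (s≤s (s≤s ())))

lemma15 : {c ℓ : Level} (R : CommutativeRing c ℓ) → NoZeroDivisors R → CharZero R →
          (ψ : CommutativeRing.Carrier R) (b : ℕ) → 3 ≤ b → ¬ (b % 4 ≡ 0) → HasOrder R ψ b →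
          (t : ℕ) →
          ¬ (CommutativeRing._≈_ R (P₁ R t ψ) (CommutativeRing.0# R)) ×
          ¬ (CommutativeRing._≈_ R (P₂ R t ψ) (CommutativeRing.0# R))
lemma15 R nzd char0 ψ zero    () _ _ _
lemma15 R nzd char0 ψ (suc n) 3≤b b%4≢0 (ψᵇ≈1 , minimal) t =
  (λ P₁≈0 → ψ⁸≢1[2] (twice-cancel-^ (2 ℕ.* t) (_ , span-^ 5 +ₛ -ₛ span-^ (4 ℕ.* t ℕ.+ 3) , P₁-root t ψ P₁≈0))) ,
  (λ P₂≈0 → ψ⁸≢1[2] (twice-cancel-^ (2 ℕ.* t) (_ , span-^ (4 ℕ.* t ℕ.+ 3) +ₛ -ₛ span-^ 5 , P₂-root t ψ P₂≈0)))
  where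
  open CommutativeRing R using (_≈_; _-_; 1#; trans)
  open Mod2 R
  open Powers ψ n ψᵇ≈1

  ψ⁸≉1 : ¬ ψ ^ 8 ≈ 1#
  ψ⁸≉1 = 8%b≢0 (suc n) 3≤b b%4≢0 ∘ ^≈1⇒%≡0 minimal 8

  ψ⁸≢1[2] : ¬ TwiceSpan powers (ψ ^ 8 - 1#)
  ψ⁸≢1[2] with ∣8*odd (suc n) b%4≢0
  ... | q , b∣8m = odd-order-root-≢1 nzd char0 q (span-^ 8) ψ⁸≉1 (trans (^-assocʳ ψ 8 (suc (2 ℕ.* q))) (^-∣ b∣8m))
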